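{- Let $n\ge 1$. There is a bijection $\omega:\mathcal{T}_n\to\mathcal{A}_n$ such that $p(T)=\mathrm{Last}(\omega(T))$ for all $T\in\mathcal{T}_n$. In particular, for every $1\le k\le n$, $\omega$ restricts to a bijection from $\mathcal{T}_{n,k}=\{T\in\mathcal{T}_n: p(T)=k\}$ onto $\mathcal{A}_{n,k}=\{\sigma\in\mathcal{A}_n:\sigma_n=k\}$.
   Context: An increasing 1-2 tree on $[n]=\{1,\dots,n\}$ is a rooted tree with vertex set $[n]$ in which every vertex has at most two children and labels increase along every path going up from the root. Convention: if a vertex has a unique child, that child is its left child; if it has two children, the smaller one is the left child and the larger one the right child. $\mathcal{T}_n$ is the set of increasing 1-2 trees on $[n]$. The minimal path of $T$ is the sequence $v_1,\dots,v_\ell$ with $v_1$ the root, $v_{i+1}$ the left child of $v_i$, and $v_\ell$ a leaf; $p(T)=v_\ell$ is the minimal leaf. For a permutation $\sigma=\sigma_1\cdots\sigma_n$ of $[n]$, $\mathrm{Last}(\sigma)=\sigma_n$, and $\sigma_{[k]}$ denotes the subword of $\sigma$ consisting of the letters $1,\dots,k$ in the order they appear in $\sigma$. A double descent is a triple of consecutive letters $a>b>c$; a word ends with an ascent if its last two letters $x,y$ satisfy $x<y$. $\sigma$ is an André permutation if for every $1\le k\le n$, $\sigma_{[k]}$ has no double descents and ends with an ascent (the ascent condition being vacuous when the word has length 1). $\mathcal{A}_n$ is the set of André permutations of $[n]$. -}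

module Defs where

open import Data.Nat using (ℕ; zero; suc; _<_; _>_; _≤?_)
open import Data.List using (List; []; _∷_; _++_; map; upTo; filter)
open import Data.List.Relation.Binary.Permutation.Propositional using (_↭_)
open import Data.Product using (_×_)
open import Data.Unit using (⊤)
open import Relation.Nullary using (¬_)

-- Rooted labelled trees in which every vertex has at most two children.
-- A vertex with a unique child stores it as its (left) child; a vertex with
-- two children stores them as (left, right).
data Tree : Set where
  leaf   : ℕ → Tree
  unary  : ℕ → Tree → Tree
  binary : ℕ → Tree → Tree → Tree

root : Tree → ℕ
root (leaf a)       = a
root (unary a _)    = a
root (binary a _ _) = a

labels : Tree → List ℕ
labels (leaf a)       = a ∷ []
labels (unary a t)    = a ∷ labels t
labels (binary a l r) = a ∷ labels l ++ labels r

-- labels increase from parent to child, and (convention) left child < right child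
Increasing : Tree → Set
Increasing (leaf a)       = ⊤
Increasing (unary a t)    = a < root t × Increasing t
Increasing (binary a l r) = a < root l × root l < root r × Increasing l × Increasing r

range : ℕ → List ℕ
range n = map suc (upTo n)

IsIncTree : ℕ → Tree → Set
IsIncTree n T = labels T ↭ range n × Increasing T

-- p(T): the leaf ending the minimal path (follow left children from the root)
minLeaf : Tree → ℕ
minLeaf (leaf a)       = a
minLeaf (unary a t)    = minLeaf t
minLeaf (binary a l r) = minLeaf l

-- Last(σ) (σ nonempty in use; 0 for the empty word)
Last : List ℕ → ℕ
Last []           = 0
Last (x ∷ [])     = x
Last (x ∷ y ∷ xs) = Last (y ∷ xs)

restrict : ℕ → List ℕ → List ℕ
restrict k σ = filter (_≤? k) σ

NoDoubleDescent : List ℕ → Set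
NoDoubleDescent (a ∷ b ∷ c ∷ rest) = ¬ (a > b × b > c) × NoDoubleDescent (b ∷ c ∷ rest)
NoDoubleDescent _                  = ⊤

EndsWithAscent : List ℕ → Set
EndsWithAscent (x ∷ y ∷ [])     = x < y
EndsWithAscent (x ∷ y ∷ z ∷ r)  = EndsWithAscent (y ∷ z ∷ r)
EndsWithAscent _                = ⊤

IsAndre : ℕ → List ℕ → Set
IsAndre n σ = σ ↭ range n ×
  (∀ k → 1 Data.Nat.≤ k → k Data.Nat.≤ n →
     NoDoubleDescent (restrict k σ) × EndsWithAscent (restrict k σ))

module Submission where

-- The bijection ω reads an increasing 1-2 tree with root a, left subtree L
-- and right subtree R as the word  ω(T) = ω(R) · a · ω(L)  (a unary vertex
-- has only L).  The root is the smallest label, so ω(T) factors around its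
-- minimum letter into a block "before" and a block "after" it.
--
-- Call a word good if it has no double descent
--    and ends with an ascent.  Around a minimum letter m, u · m · v is good
--    iff u and v are good and v is empty only if u is.
-- 3. Since σ_[k] of u · m · v is σ_[k] u · m · σ_[k] v (or empty when k < m),
--    u · m · v is André iff u and v are André and every letter of u has a
--    smaller letter in v.  That is exactly the shape of ω of a tree whose
--    left root is below its right root.
-- 4. Injectivity: a factorisation around a strict minimum is unique.
--    Surjectivity: factor an André permutation at its minimum and recurse.

open import Defs
open import Data.Nat using (ℕ; zero; suc; _≤_; _<_; _≤?_; z≤n; s≤s)
open import Data.Nat.Properties
open import Data.List using (List; []; _∷_; _++_; length)
open import Data.List.Properties
  using (filter-++; filter-accept; filter-all; filter-none; ∷-injective; ++-conicalʳ;
         length-++-sucʳ; length-++-≤ˡ; length-++-≤ʳ)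
open import Data.List.Relation.Unary.All as All using (All; []; _∷_)
import Data.List.Relation.Unary.All.Properties as AllP
open import Data.List.Relation.Unary.AllPairs using ([]; _∷_)
open import Data.List.Relation.Unary.Unique.Propositional using (Unique)
import Data.List.Relation.Unary.Unique.Propositional.Properties as UniqueP
open import Data.List.Relation.Unary.Any using (here; there)
open import Data.List.Membership.Propositional using (_∈_)
open import Data.List.Membership.Propositional.Properties
  using (∈-filter⁺; ∈-filter⁻; ∈-map⁻; ∈-map⁺; ∈-upTo⁻; ∈-upTo⁺; ∈-++⁺ʳ)
open import Data.List.Relation.Binary.Permutation.Propositional
  using (_↭_; ↭-sym; ↭-trans; ↭-refl; prep; ↭⇒↭ₛ)
open import Data.List.Relation.Binary.Permutation.Propositional.Properties
  using (∈-resp-↭; ++-comm; ++⁺; shift)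
open import Relation.Binary.PropositionalEquality
  using (_≡_; refl; sym; trans; cong; cong₂; subst; setoid)
open import Data.List.Relation.Binary.Permutation.Setoid.Properties (setoid ℕ)
  using (Unique-resp-↭)
open import Data.Product using (Σ; ∃; _×_; _,_; proj₁; proj₂)
open import Data.Empty using (⊥; ⊥-elim)
open import Data.Unit using (tt)
open import Relation.Nullary using (¬_; yes; no)
open import Relation.Binary.Definitions using (tri<; tri≈; tri>)

mutual
  ω : Tree → List ℕ
  ω T = before T ++ root T ∷ after T

  before : Tree → List ℕ
  before (binary _ _ r) = ω r
  before _              = []

  after : Tree → List ℕ
  after (leaf _)       = []
  after (unary _ t)    = ω t
  after (binary _ l _) = ω l

ω-nonempty : ∀ T → ¬ ω T ≡ []
ω-nonempty T e with ++-conicalʳ (before T) (root T ∷ after T) e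
... | ()

root∈ω : ∀ T → root T ∈ ω T
root∈ω T = ∈-++⁺ʳ (before T) (here refl)

ω↭labels : ∀ T → ω T ↭ labels T
ω↭labels (leaf a)       = ↭-refl
ω↭labels (unary a t)    = prep a (ω↭labels t)
ω↭labels (binary a l r) =
  ↭-trans (shift a (ω r) (ω l))
          (prep a (↭-trans (++-comm (ω r) (ω l)) (++⁺ (ω↭labels l) (ω↭labels r))))

Last-after : ∀ u {a : ℕ} {v} → ¬ v ≡ [] → Last (u ++ a ∷ v) ≡ Last v
Last-after []          {v = []}    v≢[] = ⊥-elim (v≢[] refl)
Last-after []          {v = _ ∷ _} _    = refl
Last-after (_ ∷ [])    v≢[] = Last-after [] v≢[]
Last-after (_ ∷ y ∷ u) v≢[] = Last-after (y ∷ u) v≢[]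

minLeaf≡Last : ∀ T → minLeaf T ≡ Last (ω T)
minLeaf≡Last (leaf a)       = refl
minLeaf≡Last (unary a t)    = trans (minLeaf≡Last t) (sym (Last-after [] (ω-nonempty t)))
minLeaf≡Last (binary a l r) = trans (minLeaf≡Last l) (sym (Last-after (ω r) (ω-nonempty l)))

below-all : ∀ {a b} {xs : List ℕ} → a < b → All (b ≤_) xs → All (a <_) xs
below-all a<b = All.map (<-≤-trans a<b)

mutual
  root-minimal : ∀ T → Increasing T → All (root T ≤_) (ω T)
  root-minimal T inc with root-strict T inc
  ... | b , a = AllP.++⁺ (All.map <⇒≤ b) (≤-refl ∷ All.map <⇒≤ a)

  root-strict : ∀ T → Increasing T → All (root T <_) (before T) × All (root T <_) (after T)
  root-strict (leaf a)       _                   = [] , []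
  root-strict (unary a t)    (a<t , it)          = [] , below-all a<t (root-minimal t it)
  root-strict (binary a l r) (a<l , l<r , il , ir) =
    below-all (<-trans a<l l<r) (root-minimal r ir) , below-all a<l (root-minimal l il)

Good : List ℕ → Set
Good w = NoDoubleDescent w × EndsWithAscent w

nd-cons : ∀ {a} w → All (a <_) w → NoDoubleDescent w → NoDoubleDescent (a ∷ w)
nd-cons []          _         _  = tt
nd-cons (_ ∷ [])    _         _  = tt
nd-cons (_ ∷ _ ∷ _) (a<z ∷ _) nd = (λ (a>z , _) → <-asym a<z a>z) , nd

nd-glue : ∀ {m} u v → All (m <_) u → All (m <_) v → Good u → NoDoubleDescent v →
          NoDoubleDescent (u ++ m ∷ v)
nd-glue []               v _              Av _             ndv = nd-cons v Av ndv
nd-glue (_ ∷ [])         []      _        _           _    _   = tt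
nd-glue (_ ∷ [])         (z ∷ v) _        (m<z ∷ Av)  _    ndv =
  (λ (_ , m>z) → <-asym m<z m>z) , nd-cons (z ∷ v) (m<z ∷ Av) ndv
nd-glue (_ ∷ y ∷ [])     v (_ ∷ m<y ∷ []) Av (_ , x<y)     ndv =
  (λ (x>y , _) → <-asym x<y x>y) , nd-glue (y ∷ []) v (m<y ∷ []) Av (tt , tt) ndv
nd-glue (_ ∷ y ∷ z ∷ u)  v (_ ∷ Au)       Av ((d , nd) , ea) ndv =
  d , nd-glue (y ∷ z ∷ u) v Au Av (nd , ea) ndv

ea-cons : ∀ (p : ℕ) w {x y} r → EndsWithAscent (w ++ x ∷ y ∷ r) →
          EndsWithAscent (p ∷ w ++ x ∷ y ∷ r)
ea-cons _ []          _ e = e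
ea-cons _ (_ ∷ [])    _ e = e
ea-cons _ (_ ∷ _ ∷ _) _ e = e

ea-prepend : ∀ w {x y : ℕ} r → EndsWithAscent (x ∷ y ∷ r) → EndsWithAscent (w ++ x ∷ y ∷ r)
ea-prepend []      r e = e
ea-prepend (p ∷ w) r e = ea-cons p w r (ea-prepend w r e)

ea-glue : ∀ {m} u v → All (m <_) v → EndsWithAscent v → (v ≡ [] → u ≡ []) →
          EndsWithAscent (u ++ m ∷ v)
ea-glue u []           _          _ u≡[] rewrite u≡[] refl = tt
ea-glue u (_ ∷ [])     (m<z ∷ _)  _ _ = ea-prepend u [] m<z
ea-glue u (_ ∷ z ∷ v)  _          e _ = ea-prepend u (z ∷ v) e

good-glue : ∀ {m} u v → All (m <_) u → All (m <_) v → Good u → Good v →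
            (v ≡ [] → u ≡ []) → Good (u ++ m ∷ v)
good-glue u v Au Av gu (ndv , eav) v≡[]⇒u≡[] =
  nd-glue u v Au Av gu ndv , ea-glue u v Av eav v≡[]⇒u≡[]

nd-prefix : ∀ u s → NoDoubleDescent (u ++ s) → NoDoubleDescent u
nd-prefix []              _ _        = tt
nd-prefix (_ ∷ [])        _ _        = tt
nd-prefix (_ ∷ _ ∷ [])    _ _        = tt
nd-prefix (_ ∷ y ∷ z ∷ u) s (d , nd) = d , nd-prefix (y ∷ z ∷ u) s nd

nd-tail : ∀ {p : ℕ} s → NoDoubleDescent (p ∷ s) → NoDoubleDescent s
nd-tail []          _  = tt
nd-tail (_ ∷ [])    _  = tt
nd-tail (_ ∷ _ ∷ _) nd = proj₂ nd

nd-suffix : ∀ u s → NoDoubleDescent (u ++ s) → NoDoubleDescent s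
nd-suffix []      _ nd = nd
nd-suffix (_ ∷ u) s nd = nd-suffix u s (nd-tail (u ++ s) nd)

ea-tail : ∀ {p : ℕ} s → EndsWithAscent (p ∷ s) → EndsWithAscent s
ea-tail []          _ = tt
ea-tail (_ ∷ [])    _ = tt
ea-tail (_ ∷ _ ∷ _) e = e

ea-suffix : ∀ u s → EndsWithAscent (u ++ s) → EndsWithAscent s
ea-suffix []      _ e = e
ea-suffix (_ ∷ u) s e = ea-suffix u s (ea-tail (u ++ s) e)

-- the block before a minimum m ends with an ascent: its last two letters
-- p, q exceed m, so p > q would give the double descent p q m
ea-before-min : ∀ {m} u v → NoDoubleDescent (u ++ m ∷ v) → All (m <_) u → Unique u →
                EndsWithAscent u
ea-before-min []              _ _  _              _        = tt
ea-before-min (_ ∷ [])        _ _  _              _        = tt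
ea-before-min (p ∷ q ∷ [])    _ nd (_ ∷ m<q ∷ []) ((p≢q ∷ []) ∷ _) =
  ≤∧≢⇒< (≮⇒≥ (λ q<p → proj₁ nd (q<p , m<q))) p≢q
ea-before-min (_ ∷ q ∷ r ∷ u) v nd (_ ∷ Au)       (_ ∷ U)  = ea-before-min (q ∷ r ∷ u) v (proj₂ nd) Au U

good-split : ∀ {m} u v → All (m <_) u → Unique u → Good (u ++ m ∷ v) → Good u × Good v
good-split {m} u v Au U (nd , ea) =
  (nd-prefix u (m ∷ v) nd , ea-before-min u v nd Au U) ,
  (nd-tail v (nd-suffix u (m ∷ v) nd) , ea-tail v (ea-suffix u (m ∷ v) ea))

no-ascent-into-min : ∀ {m} u → All (m <_) u → ¬ u ≡ [] → ¬ EndsWithAscent (u ++ m ∷ [])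
no-ascent-into-min []          _          u≢[] _ = u≢[] refl
no-ascent-into-min (_ ∷ [])    (m<p ∷ _)  _    e = <-asym m<p e
no-ascent-into-min (_ ∷ q ∷ u) (_ ∷ Au)   _    e =
  no-ascent-into-min (q ∷ u) Au (λ ()) (ea-tail (q ∷ u ++ _ ∷ []) e)

Andre : List ℕ → Set
Andre w = ∀ k → Good (restrict k w)

CoveredBelow : List ℕ → List ℕ → Set
CoveredBelow u v = ∀ {x} → x ∈ u → ∃ λ y → y ∈ v × y ≤ x

restrict-below : ∀ {k} w → All (k <_) w → restrict k w ≡ []
restrict-below w A = filter-none (_≤? _) (All.map <⇒≱ A)

restrict-keep : ∀ {k m} u v → m ≤ k → restrict k (u ++ m ∷ v) ≡ restrict k u ++ m ∷ restrict k v
restrict-keep {k} u v m≤k =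
  trans (filter-++ (_≤? k) u (_ ∷ v)) (cong (restrict k u ++_) (filter-accept (_≤? k) m≤k))

above-min : ∀ {k m} u v → k < m → All (m <_) u → All (m <_) v → All (k <_) (u ++ m ∷ v)
above-min u v k<m Au Av = AllP.++⁺ (All.map (<-trans k<m) Au) (k<m ∷ All.map (<-trans k<m) Av)

restrict-covered : ∀ {k u v} → CoveredBelow u v → restrict k v ≡ [] → restrict k u ≡ []
restrict-covered {k} {u} {v} covered v≡[] with restrict k u in eq
... | []    = refl
... | x ∷ _ with ∈-filter⁻ (_≤? k) (subst (x ∈_) (sym eq) (here refl))
...   | x∈u , x≤k with covered x∈u
...     | y , y∈v , y≤x with subst (y ∈_) v≡[] (∈-filter⁺ (_≤? k) y∈v (≤-trans y≤x x≤k))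
...       | ()

andre-glue : ∀ {m} u v → All (m <_) u → All (m <_) v → Andre u → Andre v →
             CoveredBelow u v → Andre (u ++ m ∷ v)
andre-glue {m} u v Au Av andre-u andre-v covered k with m ≤? k
... | yes m≤k = subst Good (sym (restrict-keep u v m≤k))
  (good-glue (restrict k u) (restrict k v) (AllP.filter⁺ (_≤? k) Au) (AllP.filter⁺ (_≤? k) Av)
             (andre-u k) (andre-v k) (restrict-covered covered))
... | no m≰k = subst Good (sym (restrict-below (u ++ m ∷ v) (above-min u v (≰⇒> m≰k) Au Av))) (tt , tt)

andre-split : ∀ {m} u v → All (m <_) u → All (m <_) v → Unique u → Andre (u ++ m ∷ v) →
              Andre u × Andre v
andre-split {m} u v Au Av U andre = (λ k → proj₁ (split k)) , (λ k → proj₂ (split k))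
  where
  split : ∀ k → Good (restrict k u) × Good (restrict k v)
  split k with m ≤? k
  ... | yes m≤k = good-split (restrict k u) (restrict k v) (AllP.filter⁺ (_≤? k) Au)
                    (UniqueP.filter⁺ (_≤? k) U) (subst Good (restrict-keep u v m≤k) (andre k))
  ... | no m≰k rewrite restrict-below u (All.map (<-trans (≰⇒> m≰k)) Au)
                     | restrict-below v (All.map (<-trans (≰⇒> m≰k)) Av) = (tt , tt) , (tt , tt)

unique-around : ∀ {m : ℕ} u v → Unique (u ++ m ∷ v) → Unique u × Unique v
unique-around []      _ (_ ∷ Uv) = [] , Uv
unique-around (_ ∷ u) v (x∉ ∷ U) with unique-around u v U
... | Uu , Uv = AllP.++⁻ˡ u x∉ ∷ Uu , Uv

disjoint : ∀ {x : ℕ} u s → Unique (u ++ s) → x ∈ u → x ∈ s → ⊥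
disjoint (_ ∷ u) s (x∉ ∷ _) (here refl) x∈s = All.lookup x∉ (∈-++⁺ʳ u x∈s) refl
disjoint (_ ∷ u) s (_ ∷ U)  (there x∈u) x∈s = disjoint u s U x∈u x∈s

-- converse of andre-glue: in an André word u · m · v every letter x of u
-- has a smaller letter in v, for otherwise σ_[x] would end in x ... m
smaller-after : ∀ {m x} u v → All (m <_) u → Unique (u ++ m ∷ v) → Andre (u ++ m ∷ v) →
                x ∈ u → ∃ λ y → y ∈ v × y < x
smaller-after {m} {x} u v Au U andre x∈u with restrict x v in eq
... | [] = ⊥-elim (no-ascent-into-min (restrict x u) (AllP.filter⁺ (_≤? x) Au) u-nonempty (proj₂ good-x))
  where
  m≤x : m ≤ x
  m≤x = <⇒≤ (All.lookup Au x∈u)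
  -- σ_[x] of u · m · v is σ_[x] u · m, which must still be good
  good-x : Good (restrict x u ++ m ∷ [])
  good-x = subst Good (trans (restrict-keep u v m≤x) (cong (λ s → restrict x u ++ m ∷ s) eq)) (andre x)
  u-nonempty : ¬ restrict x u ≡ []
  u-nonempty e with subst (x ∈_) e (∈-filter⁺ (_≤? x) x∈u ≤-refl)
  ... | ()
... | y ∷ _ with ∈-filter⁻ (_≤? x) (subst (y ∈_) (sym eq) (here refl))
...   | y∈v , y≤x = y , y∈v , ≤∧≢⇒< y≤x (λ { refl → disjoint u (m ∷ v) U x∈u (there y∈v) })

andre-[] : Andre []
andre-[] _ = tt , tt

ω-andre : ∀ T → Increasing T → Andre (ω T)
ω-andre (leaf a)       _          = andre-glue {a} [] [] [] [] andre-[] andre-[] (λ ())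
ω-andre (unary a t)    (a<t , it) =
  andre-glue [] (ω t) [] (below-all a<t (root-minimal t it)) andre-[] (ω-andre t it) (λ ())
ω-andre (binary a l r) (a<l , l<r , il , ir) =
  andre-glue (ω r) (ω l) (below-all (<-trans a<l l<r) (root-minimal r ir)) (below-all a<l (root-minimal l il))
             (ω-andre r ir) (ω-andre l il) covered
  where
  covered : CoveredBelow (ω r) (ω l)
  covered x∈ωr = root l , root∈ω l , <⇒≤ (<-≤-trans l<r (All.lookup (root-minimal r ir) x∈ωr))

min-factorisation-unique : ∀ {a b : ℕ} u₁ v₁ u₂ v₂ → All (a <_) u₁ → All (a <_) v₁ →
  All (b <_) u₂ → All (b <_) v₂ → u₁ ++ a ∷ v₁ ≡ u₂ ++ b ∷ v₂ → u₁ ≡ u₂ × a ≡ b × v₁ ≡ v₂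
min-factorisation-unique [] _ [] _ _ _ _ _ e with ∷-injective e
... | a≡b , v₁≡v₂ = refl , a≡b , v₁≡v₂
min-factorisation-unique [] _ (_ ∷ u₂) _ _ A₁ (b<a ∷ _) _ e with ∷-injective e
... | refl , refl = ⊥-elim (<-asym b<a (All.head (AllP.++⁻ʳ u₂ A₁)))
min-factorisation-unique (_ ∷ u₁) _ [] _ (a<b ∷ _) _ _ B₂ e with ∷-injective e
... | refl , refl = ⊥-elim (<-asym a<b (All.head (AllP.++⁻ʳ u₁ B₂)))
min-factorisation-unique (x ∷ u₁) v₁ (_ ∷ u₂) v₂ (_ ∷ A₁) Av₁ (_ ∷ B₂) Bv₂ e with ∷-injective e
... | refl , e′ with min-factorisation-unique u₁ v₁ u₂ v₂ A₁ Av₁ B₂ Bv₂ e′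
...   | u₁≡u₂ , a≡b , v₁≡v₂ = cong (x ∷_) u₁≡u₂ , a≡b , v₁≡v₂

ω-injective : ∀ T₁ T₂ → Increasing T₁ → Increasing T₂ → ω T₁ ≡ ω T₂ → T₁ ≡ T₂

same-blocks : ∀ T₁ T₂ → Increasing T₁ → Increasing T₂ → before T₁ ≡ before T₂ →
              root T₁ ≡ root T₂ → after T₁ ≡ after T₂ → T₁ ≡ T₂
same-blocks (leaf _)       (leaf _)         _ _ _ refl _ = refl
same-blocks (leaf _)       (unary _ t)      _ _ _ _    e = ⊥-elim (ω-nonempty t (sym e))
same-blocks (leaf _)       (binary _ _ r)   _ _ e _    _ = ⊥-elim (ω-nonempty r (sym e))
same-blocks (unary _ t)    (leaf _)         _ _ _ _    e = ⊥-elim (ω-nonempty t e)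
same-blocks (unary a t)    (unary _ t′)     (_ , i) (_ , i′) _ refl e = cong (unary a) (ω-injective t t′ i i′ e)
same-blocks (unary _ _)    (binary _ _ r)   _ _ e _    _ = ⊥-elim (ω-nonempty r (sym e))
same-blocks (binary _ _ r) (leaf _)         _ _ e _    _ = ⊥-elim (ω-nonempty r e)
same-blocks (binary _ _ r) (unary _ _)      _ _ e _    _ = ⊥-elim (ω-nonempty r e)
same-blocks (binary a l r) (binary _ l′ r′) (_ , _ , il , ir) (_ , _ , il′ , ir′) eb refl ea =
  cong₂ (binary a) (ω-injective l l′ il il′ ea) (ω-injective r r′ ir ir′ eb)

ω-injective T₁ T₂ i₁ i₂ e with root-strict T₁ i₁ | root-strict T₂ i₂
... | B₁ , A₁ | B₂ , A₂ with min-factorisation-unique (before T₁) (after T₁) (before T₂) (after T₂) B₁ A₁ B₂ A₂ e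
...   | eb , er , ea = same-blocks T₁ T₂ i₁ i₂ eb er ea

min-factorisation : ∀ w → ¬ w ≡ [] → Unique w →
  ∃ λ u → ∃ λ m → ∃ λ v → w ≡ u ++ m ∷ v × All (m <_) u × All (m <_) v
min-factorisation []          w≢[] _ = ⊥-elim (w≢[] refl)
min-factorisation (x ∷ [])    _    _ = [] , x , [] , refl , [] , []
min-factorisation (x ∷ y ∷ w) _    (x∉ ∷ U) with min-factorisation (y ∷ w) (λ ()) U
... | u , m , v , eq , Au , Av with <-cmp x m
...   | tri< x<m _ _ = [] , x , y ∷ w , refl , [] , subst (All (x <_)) (sym eq) (above-min u v x<m Au Av)
...   | tri≈ _ refl _ = ⊥-elim (All.lookup x∉ (subst (x ∈_) (sym eq) (∈-++⁺ʳ u (here refl))) refl)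
...   | tri> _ _ m<x = x ∷ u , m , v , cong (x ∷_) eq , m<x ∷ Au , Av

Preimage : List ℕ → Set
Preimage w = Σ Tree λ T → Increasing T × ω T ≡ w

root-of-preimage : ∀ {w} ((T , _ , _) : Preimage w) → root T ∈ w × All (root T ≤_) w
root-of-preimage (T , inc , refl) = root∈ω T , root-minimal T inc

assemble : ∀ {m} u v → All (m <_) v → (∀ {x} → x ∈ u → ∃ λ y → y ∈ v × y < x) →
           (¬ u ≡ [] → Preimage u) → (¬ v ≡ [] → Preimage v) → Preimage (u ++ m ∷ v)
assemble {m} [] [] _ _ _ _ = leaf m , tt , refl
assemble {m} [] (_ ∷ _) Av _ _ tree-v with tree-v (λ ())
... | Tv , iv , ev = unary m Tv , (All.lookup Av (proj₁ (root-of-preimage (Tv , iv , ev))) , iv) ,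
                     cong (m ∷_) ev
assemble (_ ∷ _) [] _ smaller _ _ with smaller (here refl)
... | _ , () , _
assemble {m} (_ ∷ _) (_ ∷ _) Av smaller tree-u tree-v with tree-u (λ ()) | tree-v (λ ())
... | Tu , iu , eu | Tv , iv , ev =
  binary m Tv Tu , (m<Tv , Tv<Tu , iv , iu) , cong₂ (λ s t → s ++ m ∷ t) eu ev
  where
  m<Tv : m < root Tv
  m<Tv = All.lookup Av (proj₁ (root-of-preimage (Tv , iv , ev)))
  Tv<Tu : root Tv < root Tu
  Tv<Tu with smaller (proj₁ (root-of-preimage (Tu , iu , eu)))
  ... | z , z∈v , z<Tu = ≤-<-trans (All.lookup (proj₂ (root-of-preimage (Tv , iv , ev))) z∈v) z<Tu

preimage : ∀ N w → length w ≤ N → Unique w → Andre w → ¬ w ≡ [] → Preimage w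
preimage zero    []      _  _ _ w≢[] = ⊥-elim (w≢[] refl)
preimage zero    (_ ∷ _) ()
preimage (suc N) w       len U andre w≢[] with min-factorisation w w≢[] U
... | u , m , v , refl , Au , Av with unique-around u v U | andre-split u v Au Av (proj₁ (unique-around u v U)) andre
...   | Uu , Uv | andre-u , andre-v =
  assemble u v Av (smaller-after u v Au U andre)
    (preimage N u (≤-trans (length-++-≤ˡ u) parts≤N) Uu andre-u)
    (preimage N v (≤-trans (length-++-≤ʳ v {u}) parts≤N) Uv andre-v)
  where
  parts≤N : length (u ++ v) ≤ N
  parts≤N = ≤-pred (subst (_≤ suc N) (length-++-sucʳ u m v) len)

in-range : ∀ {n σ x} → σ ↭ range n → x ∈ σ → 1 ≤ x × x ≤ n
in-range σ↭ x∈σ with ∈-map⁻ suc (∈-resp-↭ σ↭ x∈σ)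
... | _ , y∈ , refl = s≤s z≤n , ∈-upTo⁻ y∈

-- σ_[k] is empty for k = 0 and equals σ for k ≥ n, so only 1 ≤ k ≤ n matters
andre-of-IsAndre : ∀ n σ → 1 ≤ n → IsAndre n σ → Andre σ
andre-of-IsAndre n σ _ (σ↭ , _) zero
  rewrite restrict-below σ (All.tabulate λ x∈σ → proj₁ (in-range σ↭ x∈σ)) = tt , tt
andre-of-IsAndre n σ 1≤n (σ↭ , andre) (suc k) with suc k ≤? n
... | yes k≤n = andre (suc k) (s≤s z≤n) k≤n
... | no k≰n = subst Good (trans (restrict-all n ≤-refl) (sym (restrict-all (suc k) (<⇒≤ (≰⇒> k≰n)))))
                 (andre n 1≤n ≤-refl)
  where
  restrict-all : ∀ j → n ≤ j → restrict j σ ≡ σ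
  restrict-all j n≤j = filter-all (_≤? j) (All.tabulate λ x∈σ → ≤-trans (proj₂ (in-range σ↭ x∈σ)) n≤j)

ω-surjective : ∀ n → 1 ≤ n → ∀ σ → IsAndre n σ → ∃ λ T → IsIncTree n T × ω T ≡ σ
ω-surjective n 1≤n σ (σ↭ , andre)
  with preimage (length σ) σ ≤-refl unique-σ (andre-of-IsAndre n σ 1≤n (σ↭ , andre)) σ-nonempty
  where
  unique-σ : Unique σ
  unique-σ = Unique-resp-↭ (↭⇒↭ₛ (↭-sym σ↭)) (UniqueP.map⁺ suc-injective (UniqueP.upTo⁺ n))
  σ-nonempty : ¬ σ ≡ []
  σ-nonempty refl with ∈-resp-↭ (↭-sym σ↭) (∈-map⁺ suc (∈-upTo⁺ {n} {0} 1≤n))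
  ... | ()
... | T , inc , refl = T , (↭-trans (↭-sym (ω↭labels T)) σ↭ , inc) , refl

theorem2p5 : (n : ℕ) → 1 ≤ n →
    Σ (Tree → List ℕ) (λ ω →
      (∀ T → IsIncTree n T → IsAndre n (ω T)) ×
      (∀ T₁ T₂ → IsIncTree n T₁ → IsIncTree n T₂ → ω T₁ ≡ ω T₂ → T₁ ≡ T₂) ×
      (∀ σ → IsAndre n σ → ∃ (λ T → IsIncTree n T × ω T ≡ σ)) ×
      (∀ T → IsIncTree n T → minLeaf T ≡ Last (ω T)))
theorem2p5 n 1≤n =
  ω ,
  (λ T (labels↭ , inc) → ↭-trans (ω↭labels T) labels↭ , λ k _ _ → ω-andre T inc k) ,
  (λ T₁ T₂ (_ , inc₁) (_ , inc₂) → ω-injective T₁ T₂ inc₁ inc₂) ,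
  ω-surjective n 1≤n ,
  (λ T _ → minLeaf≡Last T)
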